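{- Let $M$ be a term and $e_1,e_2:\mathrm{Var}\to\mathrm{Val}$ environments with $e_1(x)\subseteq e_2(x)$ for all $x\in\mathrm{Var}$ and $\mathrm{FV}(M)\subseteq\{x:e_1(x)\neq\emptyset\}$. Then $[\![M]\!]e_1\alpha\subseteq[\![M]\!]e_2\alpha$ for all $\alpha\in2^\omega$.
   Context: Terms: $M::=x\mid\lambda x.M\mid MN\mid M\oplus N$ over a countable set $\mathrm{Var}$; $\mathrm{FV}$ denotes free variables. $2^\omega$: infinite binary sequences; $\mathrm{hd}\,\alpha=\alpha_0$, $\mathrm{tl}\,\alpha=\alpha_1\alpha_2\cdots$, $\pi_i(\alpha)=\alpha_i\alpha_{i+3}\alpha_{i+6}\cdots$ ($i=0,1,2$); $x\prec\alpha$ means the finite string $x$ is a prefix of $\alpha$, and $I_x=\{\alpha:x\prec\alpha\}$. $Q_0=\{\emptyset\}$, $Q_{n+1}=Q_n\uplus(2^*\times\mathcal P_{\mathrm{fin}}(Q_n)\times Q_n)$, $Q=\bigcup_nQ_n$, $\mathrm{Val}=\mathcal P(Q)$. $\mathrm{fun}(a)(\beta)(v)=\{q:\exists x\prec\beta\ \exists c\in\mathcal P_{\mathrm{fin}}(v)\ (x,c,q)\in a\}$; $\mathrm{lam}(f)=\{(x,c,q)\in2^*\times\mathcal P_{\mathrm{fin}}(Q)\times Q:\forall\beta\in I_x\ q\in f\beta c\}\cup\{\emptyset\}$. The deterministic semantics $[\![M]\!]:(\mathrm{Var}\to\mathrm{Val})\to2^\omega\to\mathrm{Val}$ is: $[\![x]\!]e\alpha=e(x)$;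 $[\![MN]\!]e\alpha=\mathrm{fun}([\![M]\!]e(\pi_0\alpha))(\pi_1\alpha)([\![N]\!]e(\pi_2\alpha))$; $[\![\lambda x.M]\!]e\alpha=\mathrm{lam}(\lambda\beta v.[\![M]\!](e[v/x])\beta)$ with the inner function strict (value $\emptyset$ when $v=\emptyset$); $[\![M\oplus N]\!]e\alpha=[\![M]\!]e(\mathrm{tl}\,\alpha)$ if $\mathrm{hd}\,\alpha=1$, $[\![N]\!]e(\mathrm{tl}\,\alpha)$ if $\mathrm{hd}\,\alpha=0$. -}

module Defs where

open import Data.Nat using (ℕ; zero; suc; _+_; _*_; _≟_)
open import Data.Bool using (Bool; true; false)
open import Data.List using (List; []; _∷_)
open import Data.List.Relation.Unary.All using (All)
open import Data.List.Membership.Propositional using (_∈_)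
open import Data.Product using (Σ; _×_; _,_)
open import Data.Unit using (⊤)
open import Data.Empty using (⊥)
open import Relation.Binary.PropositionalEquality using (_≡_)
open import Relation.Nullary using (¬_; yes; no)

Var : Set
Var = ℕ

data Term : Set where
  var  : Var → Term
  lam  : Var → Term → Term
  app  : Term → Term → Term
  _⊕_  : Term → Term → Term

data _∈FV_ (x : Var) : Term → Set where
  fv-var  : x ∈FV var x
  fv-lam  : ∀ {y M} → ¬ (x ≡ y) → x ∈FV M → x ∈FV lam y M
  fv-appˡ : ∀ {M N} → x ∈FV M → x ∈FV app M N
  fv-appʳ : ∀ {M N} → x ∈FV N → x ∈FV app M N
  fv-⊕ˡ   : ∀ {M N} → x ∈FV M → x ∈FV (M ⊕ N)
  fv-⊕ʳ   : ∀ {M N} → x ∈FV N → x ∈FV (M ⊕ N)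

-- Infinite binary sequences 2^ω (true = 1, false = 0)
Seq : Set
Seq = ℕ → Bool

hd : Seq → Bool
hd α = α 0

tl : Seq → Seq
tl α n = α (suc n)

π : ℕ → Seq → Seq
π i α n = α (3 * n + i)

_≺_ : List Bool → Seq → Set
[]      ≺ α = ⊤
(b ∷ x) ≺ α = (α 0 ≡ b) × (x ≺ tl α)

-- Q = {∅} ⊎ (2* × P_fin(Q) × Q); finite sets of Q are represented by lists.
data Q : Set where
  ∅q  : Q
  tri : List Bool → List Q → Q → Q

Val : Set₁
Val = Q → Set

⟪_⟫ : List Q → Val
⟪ c ⟫ q = q ∈ c

_⊆fin_ : List Q → Val → Set
c ⊆fin v = All v c

_⊆_ : Val → Val → Set
a ⊆ b = ∀ q → a q → b q

Env : Set₁
Env = Var → Val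

_[_↦_] : Env → Var → Val → Env
(e [ x ↦ v ]) y with x ≟ y
... | yes _ = v
... | no  _ = e y

fun : Val → Seq → Val → Val
fun a β v q = Σ (List Bool) λ x → x ≺ β × Σ (List Q) λ c → c ⊆fin v × a (tri x c q)

NonEmpty : List Q → Set
NonEmpty []      = ⊥
NonEmpty (_ ∷ _) = ⊤

⟦_⟧ : Term → Env → Seq → Val
⟦ var x ⟧   e α = e x
⟦ app M N ⟧ e α = fun (⟦ M ⟧ e (π 0 α)) (π 1 α) (⟦ N ⟧ e (π 2 α))
-- lam(f) with f β v = [[M]](e[v/x])β for v ≠ ∅ and f β ∅ = ∅ (strict);
-- f is only ever applied to finite sets c, for which v = ∅ iff c is the empty list.
⟦ lam x M ⟧ e α ∅q = ⊤
⟦ lam x M ⟧ e α (tri s c q) =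
  ∀ (β : Seq) → s ≺ β → NonEmpty c × ⟦ M ⟧ (e [ x ↦ ⟪ c ⟫ ]) β q
⟦ M ⊕ N ⟧ e α with hd α
... | true  = ⟦ M ⟧ e (tl α)
... | false = ⟦ N ⟧ e (tl α)

module Submission where

open import Defs
open import Relation.Nullary using (¬_; yes; no)
open import Data.Bool using (true; false)
open import Data.Nat using (_≟_)
open import Data.Product using (_,_)
import Data.List.Relation.Unary.All as All

Env-⊆ : Env → Env → Set
Env-⊆ e₁ e₂ = ∀ x → e₁ x ⊆ e₂ x

[↦]-mono : ∀ {e₁ e₂} → Env-⊆ e₁ e₂ → ∀ x v → Env-⊆ (e₁ [ x ↦ v ]) (e₂ [ x ↦ v ])
[↦]-mono e₁⊆e₂ x v y with x ≟ y
... | yes _ = λ _ q∈v → q∈v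
... | no  _ = e₁⊆e₂ y

⊆fin-mono : ∀ {v₁ v₂} → v₁ ⊆ v₂ → ∀ {c} → c ⊆fin v₁ → c ⊆fin v₂
⊆fin-mono v₁⊆v₂ = All.map (v₁⊆v₂ _)

fun-mono : ∀ {a₁ a₂ v₁ v₂} → a₁ ⊆ a₂ → v₁ ⊆ v₂ → ∀ β → fun a₁ β v₁ ⊆ fun a₂ β v₂
fun-mono a₁⊆a₂ v₁⊆v₂ β q (x , x≺β , c , c⊆v₁ , xcq∈a₁) =
  x , x≺β , c , ⊆fin-mono v₁⊆v₂ c⊆v₁ , a₁⊆a₂ _ xcq∈a₁

⟦⟧-mono : ∀ M {e₁ e₂} → Env-⊆ e₁ e₂ → ∀ α → ⟦ M ⟧ e₁ α ⊆ ⟦ M ⟧ e₂ α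
⟦⟧-mono (var x)   e₁⊆e₂ α = e₁⊆e₂ x
⟦⟧-mono (lam x M) e₁⊆e₂ α ∅q          _ = _
⟦⟧-mono (lam x M) e₁⊆e₂ α (tri s c q) h β s≺β with h β s≺β
... | c≠∅ , q∈⟦M⟧ = c≠∅ , ⟦⟧-mono M ([↦]-mono e₁⊆e₂ x ⟪ c ⟫) β q q∈⟦M⟧
⟦⟧-mono (app M N) e₁⊆e₂ α =
  fun-mono (⟦⟧-mono M e₁⊆e₂ (π 0 α)) (⟦⟧-mono N e₁⊆e₂ (π 2 α)) (π 1 α)
⟦⟧-mono (M ⊕ N)   e₁⊆e₂ α with hd α
... | true  = ⟦⟧-mono M e₁⊆e₂ (tl α)
... | false = ⟦⟧-mono N e₁⊆e₂ (tl α)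

mainTheorem9 : (M : Term) (e₁ e₂ : Env) →
    (∀ x → e₁ x ⊆ e₂ x) →
    (∀ x → x ∈FV M → ¬ (∀ q → ¬ e₁ x q)) →
    (α : Seq) → ⟦ M ⟧ e₁ α ⊆ ⟦ M ⟧ e₂ α
mainTheorem9 M e₁ e₂ e₁⊆e₂ _ = ⟦⟧-mono M e₁⊆e₂
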